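{- Let $G$ be a finite connected graph with at least one edge and $\Delta$ a decision tree for $G$. For every subgraph $S$ of $G$, the set of subgraphs having the same history as $S$ is exactly the interval $\{S' : S\setminus\mathrm{Act}(S)\subseteq S'\subseteq S\cup\mathrm{Act}(S)\}$.
   Context: Graphs are finite, loops and multiple edges allowed; $m=|E(G)|$. Subgraphs are spanning, identified with edge sets. An isthmus is an edge whose deletion increases the number of connected components; an edge is standard if neither a loop nor an isthmus. A decision tree for $G$ is a perfect binary tree with all leaves at depth $m-1$ (root at depth $0$), each node labelled by an edge, such that along every root-to-leaf path the labels form a permutation of $E(G)$. Given a subgraph $S$: set $H:=G$, $n:=$ root of $\Delta$; for $k=1,\dots,m$ let $e_k$ be the label of $n$ and do exactly one of: (i) if $e_k$ is standard in $H$ and $e_k\notin S$: type $\mathbf S_e$, $H:=H\setminus e_k$ (deletion), $n:=$ left child; (ii) if $e_k$ is a loop of $H$: type $\mathbf L$, $H:=H\setminus e_k$, $n:=$ left child; (iii) if $e_k$ is standard in $H$ and $e_k\in S$: type $\mathbf S_i$, $H:=H/e_k$ (contraction), $n:=$ right child; (iv) if $e_k$ is an isthmus of $H$: type $\mathbf I$, $H:=H/e_k$, $n:=$ right child. $\mathrm{Act}(S)$ is the set of edges of type $\mathbf L$ or $\mathbf I$ for $S$. The history of $S$ is the sequence $(e_1,t_1),\dots,(e_m,t_m)$, $t_k$ the type of $e_k$. -}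

module Defs where

open import Data.Nat using (ℕ; zero; suc)
open import Data.Fin using (Fin)
open import Data.Fin.Subset using (Subset) renaming (_∈_ to _∈ₛ_; _∉_ to _∉ₛ_)
open import Data.Product using (_×_; _,_; proj₁; proj₂)
open import Data.Sum using (_⊎_)
open import Data.Unit using (⊤)
open import Data.List using (List; []; _∷_; _++_; map; concatMap; allFin)
open import Data.List.Membership.Propositional using () renaming (_∈_ to _∈ₗ_; _∉_ to _∉ₗ_)
open import Data.List.Relation.Binary.Permutation.Propositional using (_↭_)
open import Data.List.Relation.Unary.All using (All)
open import Relation.Binary.PropositionalEquality using (_≡_; _≢_)
open import Relation.Nullary using (¬_)

-- Finite multigraphs (loops and multiple edges allowed):
-- vertices Fin V, edges Fin m, each edge with an (unordered) pair of ends.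

record Graph (V m : ℕ) : Set where
  field
    ends : Fin m → Fin V × Fin V

module _ {V m : ℕ} (G : Graph V m) where
  open Graph G

  data Reach (P : Fin m → Set) : Fin V → Fin V → Set where
    here : ∀ {u} → Reach P u u
    fwd  : ∀ {u} e → P e → Reach P u (proj₁ (ends e)) → Reach P u (proj₂ (ends e))
    bwd  : ∀ {u} e → P e → Reach P u (proj₂ (ends e)) → Reach P u (proj₁ (ends e))

  Connected : Set
  Connected = ∀ u v → Reach (λ _ → ⊤) u v

  -- Minors H = (G \ D) / C, D = deleted edges, C = contracted edges
  -- (disjoint, and e ∉ D ∪ C is an edge of H).
  -- Vertices of H are classes of vertices of G joined by C-edges.

  Loop : List (Fin m) → Fin m → Set
  Loop C e = Reach (λ f → f ∈ₗ C) (proj₁ (ends e)) (proj₂ (ends e))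

  -- e is an isthmus of H: deleting e from H disconnects its ends
  -- (equivalently, increases the number of connected components of H)
  Isthmus : List (Fin m) → Fin m → Set
  Isthmus D e = ¬ Reach (λ f → (f ∉ₗ D) × (f ≢ e)) (proj₁ (ends e)) (proj₂ (ends e))

  Standard : List (Fin m) → List (Fin m) → Fin m → Set
  Standard D C e = (¬ Loop C e) × (¬ Isthmus D e)

data Tree (m : ℕ) : ℕ → Set where
  leaf : Fin m → Tree m zero
  node : ∀ {d} → Fin m → Tree m d → Tree m d → Tree m (suc d)

label : ∀ {m d} → Tree m d → Fin m
label (leaf e) = e
label (node e _ _) = e

paths : ∀ {m d} → Tree m d → List (List (Fin m))
paths (leaf e) = (e ∷ []) ∷ []
paths (node e l r) = map (e ∷_) (paths l ++ paths r)

IsDecisionTree : ∀ {k} → Tree (suc k) k → Set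
IsDecisionTree {k} t = All (λ p → p ↭ allFin (suc k)) (paths t)

data Ty : Set where
  Se L Si I : Ty

module _ {V m : ℕ} (G : Graph V m) where

  -- Hist D C t S h : running the algorithm for subgraph S from the
  -- current minor (G \ D)/C at (sub)tree t produces the history h.
  data Hist (S : Subset m) : List (Fin m) → List (Fin m) → ∀ {d} → Tree m d → List (Fin m × Ty) → Set where
    leaf-Se : ∀ {D C e} → Standard G D C e → e ∉ₛ S → Hist S D C (leaf e) ((e , Se) ∷ [])
    leaf-L  : ∀ {D C e} → Loop G C e → Hist S D C (leaf e) ((e , L) ∷ [])
    leaf-Si : ∀ {D C e} → Standard G D C e → e ∈ₛ S → Hist S D C (leaf e) ((e , Si) ∷ [])
    leaf-I  : ∀ {D C e} → Isthmus G D e → Hist S D C (leaf e) ((e , I) ∷ [])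
    node-Se : ∀ {D C d e h} {l r : Tree m d} → Standard G D C e → e ∉ₛ S →
              Hist S (e ∷ D) C l h → Hist S D C (node e l r) ((e , Se) ∷ h)
    node-L  : ∀ {D C d e h} {l r : Tree m d} → Loop G C e →
              Hist S (e ∷ D) C l h → Hist S D C (node e l r) ((e , L) ∷ h)
    node-Si : ∀ {D C d e h} {l r : Tree m d} → Standard G D C e → e ∈ₛ S →
              Hist S D (e ∷ C) r h → Hist S D C (node e l r) ((e , Si) ∷ h)
    node-I  : ∀ {D C d e h} {l r : Tree m d} → Isthmus G D e →
              Hist S D (e ∷ C) r h → Hist S D C (node e l r) ((e , I) ∷ h)

  HistoryOf : ∀ {d} → Tree m d → Subset m → List (Fin m × Ty) → Set
  HistoryOf t S h = Hist S [] [] t h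

Act : ∀ {m} → List (Fin m × Ty) → Fin m → Set
Act h e = ((e , L) ∈ₗ h) ⊎ ((e , I) ∈ₗ h)

-- The algorithm consults S only at standard edges: an S_e step needs
-- e ∉ S and an S_i step needs e ∈ S, while loops and isthmuses are
-- classified by the current minor alone.  Hence a history h of S is a
-- history of S′ exactly when S′ "fits" h, i.e. agrees with S on the edges
-- of type S_e and S_i (lemmas history-fits and history-transfer).
-- Moreover the edges of a history read off a root-to-leaf path of the
-- decision tree, so each edge of G occurs in h exactly once with a single
-- type.  Given that, "S′ fits h" is a pointwise restatement of the two
-- interval inclusions (lemma fits⇔interval).

module Submission where

open import Defs
open import Data.Nat using (ℕ; suc)
open import Data.Fin using (Fin; _≟_)
open import Data.Fin.Subset using (Subset) renaming (_∈_ to _∈ₛ_; _∉_ to _∉ₛ_)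
import Data.Fin.Subset.Properties as Subsetₚ
open import Data.Product using (_×_; Σ; _,_; proj₁; proj₂)
open import Data.Sum using (_⊎_; inj₁; inj₂)
open import Data.Unit using (⊤; tt)
open import Data.Empty using (⊥-elim)
open import Data.List using (List; []; _∷_; map; filter; allFin)
open import Data.List.Membership.Propositional using () renaming (_∈_ to _∈ₗ_; _∉_ to _∉ₗ_)
open import Data.List.Membership.Propositional.Properties
  using (∈-filter⁺; ∈-filter⁻; ∈-allFin; ∈-map⁺; ∈-map⁻; ∈-++⁺ˡ; ∈-++⁺ʳ)
import Data.List.Membership.DecPropositional as DecMembership
open import Data.List.Relation.Unary.Any using (here; there)
open import Data.List.Relation.Unary.All using (All; []; _∷_; tabulate) renaming (lookup to All-lookup)
open import Data.List.Relation.Unary.AllPairs using (_∷_)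
open import Data.List.Relation.Unary.Unique.Propositional using (Unique)
open import Data.List.Relation.Unary.Unique.Propositional.Properties using (allFin⁺)
open import Data.List.Relation.Binary.Permutation.Propositional using (_↭_; ↭-sym; ↭⇒↭ₛ)
open import Data.List.Relation.Binary.Permutation.Propositional.Properties using (∈-resp-↭)
import Data.List.Relation.Binary.Permutation.Setoid.Properties as PermutationₛProperties
open import Function.Bundles using (_⇔_; mk⇔; Equivalence)
open import Relation.Binary.PropositionalEquality using (_≡_; _≢_; refl; setoid)
open import Relation.Nullary using (¬_; Dec; yes; no)
open import Relation.Nullary.Decidable using (_⊎-dec_; _×-dec_; ¬?; map′)
open import Relation.Unary using (Decidable)

module Walks {V m : ℕ} (G : Graph V m) where
  open Graph G

  walk-trans : ∀ {P u v w} → Reach G P u v → Reach G P v w → Reach G P u w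
  walk-trans r here        = r
  walk-trans r (fwd e p s) = fwd e p (walk-trans r s)
  walk-trans r (bwd e p s) = bwd e p (walk-trans r s)

  walk-sym : ∀ {P u v} → Reach G P u v → Reach G P v u
  walk-sym here        = here
  walk-sym (fwd e p r) = walk-trans (bwd e p here) (walk-sym r)
  walk-sym (bwd e p r) = walk-trans (fwd e p here) (walk-sym r)

  walk-mono : ∀ {P Q : Fin m → Set} {u v} → (∀ f → P f → Q f) → Reach G P u v → Reach G Q u v
  walk-mono P⊆Q here        = here
  walk-mono P⊆Q (fwd e p r) = fwd e (P⊆Q e p) (walk-mono P⊆Q r)
  walk-mono P⊆Q (bwd e p r) = bwd e (P⊆Q e p) (walk-mono P⊆Q r)

  Via : List (Fin m) → Fin V → Fin V → Set
  Via Es = Reach G (λ f → f ∈ₗ Es)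

  via-[] : ∀ {u v} → Via [] u v → u ≡ v
  via-[] here = refl

  -- A walk via e ∷ Es from u to x can be shortcut to one that avoids e,
  -- or that uses e exactly once (in either direction).
  module Shortcut (e : Fin m) (Es : List (Fin m)) where
    a b : Fin V
    a = proj₁ (ends e)
    b = proj₂ (ends e)

    Shortcut : Fin V → Fin V → Set
    Shortcut u x = Via Es u x ⊎ ((Via Es u a × Via Es b x) ⊎ (Via Es u b × Via Es a x))

    extend : ∀ {u x y} → (∀ {z} → Via Es z x → Via Es z y) → Shortcut u x → Shortcut u y
    extend g (inj₁ r)               = inj₁ (g r)
    extend g (inj₂ (inj₁ (p , q))) = inj₂ (inj₁ (p , g q))
    extend g (inj₂ (inj₂ (p , q))) = inj₂ (inj₂ (p , g q))

    shortcut : ∀ {u x} → Via (e ∷ Es) u x → Shortcut u x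
    shortcut here = inj₁ here
    shortcut (fwd f (here refl) r) with shortcut r
    ... | inj₁ ua                = inj₂ (inj₁ (ua , here))
    ... | inj₂ (inj₁ (ua , ba)) = inj₁ (walk-trans ua (walk-sym ba))
    ... | inj₂ (inj₂ (ub , _))  = inj₁ ub
    shortcut (fwd f (there p) r) = extend (fwd f p) (shortcut r)
    shortcut (bwd f (here refl) r) with shortcut r
    ... | inj₁ ub                = inj₂ (inj₂ (ub , here))
    ... | inj₂ (inj₁ (ua , _))  = inj₁ ua
    ... | inj₂ (inj₂ (ub , ab)) = inj₁ (walk-trans ub (walk-sym ab))
    shortcut (bwd f (there p) r) = extend (bwd f p) (shortcut r)

    widen : ∀ {u x} → Via Es u x → Via (e ∷ Es) u x
    widen = walk-mono (λ _ → there)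

    unshortcut : ∀ {u x} → Shortcut u x → Via (e ∷ Es) u x
    unshortcut (inj₁ r)               = widen r
    unshortcut (inj₂ (inj₁ (p , q))) = walk-trans (widen p) (walk-trans (fwd e (here refl) here) (widen q))
    unshortcut (inj₂ (inj₂ (p , q))) = walk-trans (widen p) (walk-trans (bwd e (here refl) here) (widen q))

  via? : (Es : List (Fin m)) → ∀ u v → Dec (Via Es u v)
  via? [] u v with u ≟ v
  ... | yes refl = yes here
  ... | no u≢v   = no (λ r → u≢v (via-[] r))
  via? (e ∷ Es) u v =
    map′ unshortcut shortcut
      (via? Es u v ⊎-dec ((via? Es u a ×-dec via? Es b v) ⊎-dec (via? Es u b ×-dec via? Es a v)))
    where open Shortcut e Es

  reach? : {P : Fin m → Set} → Decidable P → ∀ u v → Dec (Reach G P u v)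
  reach? P? u v =
    map′ (walk-mono (λ f p → proj₂ (∈-filter⁻ P? {xs = allFin m} p)))
         (walk-mono (λ f p → ∈-filter⁺ P? (∈-allFin f) p))
         (via? (filter P? (allFin m)) u v)

  loop? : ∀ C e → Dec (Loop G C e)
  loop? C e = via? C _ _

  isthmus-avoided? : ∀ D e →
    Dec (Reach G (λ f → (f ∉ₗ D) × (f ≢ e)) (proj₁ (ends e)) (proj₂ (ends e)))
  isthmus-avoided? D e = reach? (λ f → ¬? (f ∈? D) ×-dec ¬? (f ≟ e)) _ _
    where open DecMembership _≟_ using (_∈?_)

-- the only information about S that a history step records
Fits : ∀ {m} → Subset m → Fin m × Ty → Set
Fits S (e , Se) = e ∉ₛ S
Fits S (e , Si) = e ∈ₛ S
Fits S (e , L)  = ⊤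
Fits S (e , I)  = ⊤

module Histories {V m : ℕ} (G : Graph V m) where
  open Walks G

  -- the algorithm runs to completion on every subgraph: each edge is a
  -- loop, an isthmus, or standard in the current minor
  history-exists : (S : Subset m) → ∀ {d} D C (t : Tree m d) → Σ (List (Fin m × Ty)) (Hist G S D C t)
  history-exists S D C (leaf e) with loop? C e
  ... | yes lp = _ , leaf-L lp
  ... | no ¬lp with isthmus-avoided? D e
  ... | no isth = _ , leaf-I isth
  ... | yes r with e Subsetₚ.∈? S
  ... | yes e∈S = _ , leaf-Si (¬lp , λ isth → isth r) e∈S
  ... | no e∉S  = _ , leaf-Se (¬lp , λ isth → isth r) e∉S
  history-exists S D C (node e l rt) with loop? C e
  ... | yes lp = _ , node-L lp (proj₂ (history-exists S (e ∷ D) C l))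
  ... | no ¬lp with isthmus-avoided? D e
  ... | no isth = _ , node-I isth (proj₂ (history-exists S D (e ∷ C) rt))
  ... | yes r with e Subsetₚ.∈? S
  ... | yes e∈S = _ , node-Si (¬lp , λ isth → isth r) e∈S (proj₂ (history-exists S D (e ∷ C) rt))
  ... | no e∉S  = _ , node-Se (¬lp , λ isth → isth r) e∉S (proj₂ (history-exists S (e ∷ D) C l))

  history-fits : ∀ {S d D C} {t : Tree m d} {h} → Hist G S D C t h → All (Fits S) h
  history-fits (leaf-Se _ e∉S)   = e∉S ∷ []
  history-fits (leaf-L _)        = tt ∷ []
  history-fits (leaf-Si _ e∈S)   = e∈S ∷ []
  history-fits (leaf-I _)        = tt ∷ []
  history-fits (node-Se _ e∉S H) = e∉S ∷ history-fits H
  history-fits (node-L _ H)      = tt ∷ history-fits H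
  history-fits (node-Si _ e∈S H) = e∈S ∷ history-fits H
  history-fits (node-I _ H)      = tt ∷ history-fits H

  history-transfer : ∀ {S S′ d D C} {t : Tree m d} {h} →
    Hist G S D C t h → All (Fits S′) h → Hist G S′ D C t h
  history-transfer (leaf-Se st _)   (e∉S′ ∷ [])  = leaf-Se st e∉S′
  history-transfer (leaf-L lp)      _             = leaf-L lp
  history-transfer (leaf-Si st _)   (e∈S′ ∷ [])  = leaf-Si st e∈S′
  history-transfer (leaf-I isth)    _             = leaf-I isth
  history-transfer (node-Se st _ H) (e∉S′ ∷ fs)  = node-Se st e∉S′ (history-transfer H fs)
  history-transfer (node-L lp H)    (_ ∷ fs)      = node-L lp (history-transfer H fs)
  history-transfer (node-Si st _ H) (e∈S′ ∷ fs)  = node-Si st e∈S′ (history-transfer H fs)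
  history-transfer (node-I isth H)  (_ ∷ fs)      = node-I isth (history-transfer H fs)

  history-path : ∀ {S d D C} {t : Tree m d} {h} → Hist G S D C t h → map proj₁ h ∈ₗ paths t
  history-path (leaf-Se _ _)   = here refl
  history-path (leaf-L _)      = here refl
  history-path (leaf-Si _ _)   = here refl
  history-path (leaf-I _)      = here refl
  history-path (node-Se _ _ H) = ∈-map⁺ _ (∈-++⁺ˡ (history-path H))
  history-path (node-L _ H)    = ∈-map⁺ _ (∈-++⁺ˡ (history-path H))
  history-path (node-Si _ _ H) = ∈-map⁺ _ (∈-++⁺ʳ _ (history-path H))
  history-path (node-I _ H)    = ∈-map⁺ _ (∈-++⁺ʳ _ (history-path H))

module EdgesOnce {m : ℕ} (h : List (Fin m × Ty)) (perm : map proj₁ h ↭ allFin m) where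

  typeOf : ∀ e → Σ Ty (λ t → (e , t) ∈ₗ h)
  typeOf e with ∈-map⁻ proj₁ (∈-resp-↭ (↭-sym perm) (∈-allFin e))
  ... | (_ , t) , e∈h , refl = t , e∈h

  edges-unique : Unique (map proj₁ h)
  edges-unique = Unique-resp-↭ (↭⇒↭ₛ (↭-sym perm)) (allFin⁺ m)
    where open PermutationₛProperties (setoid (Fin m)) using (Unique-resp-↭)

  type-unique : ∀ {e t₁ t₂} → (e , t₁) ∈ₗ h → (e , t₂) ∈ₗ h → t₁ ≡ t₂
  type-unique = go edges-unique
    where
      go : ∀ {xs : List (Fin m × Ty)} {e t₁ t₂} → Unique (map proj₁ xs) →
           (e , t₁) ∈ₗ xs → (e , t₂) ∈ₗ xs → t₁ ≡ t₂
      go (_ ∷ _)   (here refl) (here refl) = refl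
      go (fr ∷ _)  (here refl) (there q)   = ⊥-elim (All-lookup fr (∈-map⁺ proj₁ q) refl)
      go (fr ∷ _)  (there p)   (here refl) = ⊥-elim (All-lookup fr (∈-map⁺ proj₁ p) refl)
      go (_ ∷ un)  (there p)   (there q)   = go un p q

  inactive : ∀ {e t} → (e , t) ∈ₗ h → t ≢ L → t ≢ I → ¬ Act h e
  inactive p t≢L _   (inj₁ q) = t≢L (type-unique p q)
  inactive p _   t≢I (inj₂ q) = t≢I (type-unique p q)

module Interval {m : ℕ} (h : List (Fin m × Ty)) (perm : map proj₁ h ↭ allFin m) (S : Subset m) where
  open EdgesOnce h perm

  InInterval : Subset m → Set
  InInterval S′ = ((e : Fin m) → e ∈ₛ S → ¬ Act h e → e ∈ₛ S′) ×
                  ((e : Fin m) → e ∈ₛ S′ → (e ∈ₛ S) ⊎ Act h e)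

  fits⇔interval : All (Fits S) h → (S′ : Subset m) → All (Fits S′) h ⇔ InInterval S′
  fits⇔interval fitsS S′ = mk⇔ to from
    where
      to : All (Fits S′) h → InInterval S′
      to fitsS′ = lower , upper
        where
          lower : (e : Fin m) → e ∈ₛ S → ¬ Act h e → e ∈ₛ S′
          lower e e∈S ¬act with typeOf e
          ... | Se , p = ⊥-elim (All-lookup fitsS p e∈S)
          ... | L  , p = ⊥-elim (¬act (inj₁ p))
          ... | Si , p = All-lookup fitsS′ p
          ... | I  , p = ⊥-elim (¬act (inj₂ p))
          upper : (e : Fin m) → e ∈ₛ S′ → (e ∈ₛ S) ⊎ Act h e
          upper e e∈S′ with typeOf e
          ... | Se , p = ⊥-elim (All-lookup fitsS′ p e∈S′)
          ... | L  , p = inj₂ (inj₁ p)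
          ... | Si , p = inj₁ (All-lookup fitsS p)
          ... | I  , p = inj₂ (inj₂ p)

      from : InInterval S′ → All (Fits S′) h
      from (lower , upper) = tabulate fits
        where
          fits : ∀ {x} → x ∈ₗ h → Fits S′ x
          fits {e , Se} p e∈S′ with upper e e∈S′
          ... | inj₁ e∈S = All-lookup fitsS p e∈S
          ... | inj₂ act = inactive p (λ ()) (λ ()) act
          fits {e , Si} p = lower e (All-lookup fitsS p) (inactive p (λ ()) (λ ()))
          fits {e , L}  p = tt
          fits {e , I}  p = tt

corollary6p2 : {V k : ℕ} (G : Graph V (suc k)) → Connected G →
    (Δ : Tree (suc k) k) → IsDecisionTree Δ →
    (S : Subset (suc k)) →
    Σ (List (Fin (suc k) × Ty)) λ h → HistoryOf G Δ S h ×
      ((S′ : Subset (suc k)) →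
        HistoryOf G Δ S′ h ⇔
          (((e : Fin (suc k)) → e ∈ₛ S → ¬ Act h e → e ∈ₛ S′) ×
           ((e : Fin (suc k)) → e ∈ₛ S′ → (e ∈ₛ S) ⊎ Act h e)))
corollary6p2 G _ Δ isDecisionTree S = h , histS , λ S′ → characterise S′
  where
    open Histories G
    h : List (Fin _ × Ty)
    h = proj₁ (history-exists S [] [] Δ)

    histS : HistoryOf G Δ S h
    histS = proj₂ (history-exists S [] [] Δ)

    perm : map proj₁ h ↭ allFin _
    perm = All-lookup isDecisionTree (history-path histS)
    open Interval h perm S

    characterise : (S′ : Subset _) → HistoryOf G Δ S′ h ⇔ InInterval S′
    characterise S′ = mk⇔
      (λ histS′ → Equivalence.to (fits⇔interval (history-fits histS) S′) (history-fits histS′))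
      (λ inside → history-transfer histS (Equivalence.from (fits⇔interval (history-fits histS) S′) inside))
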